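{- Let $G=(V,E)$ be a temporal graph, $s\in V$, $t_s$ real, and $T$ the DFS tree produced by DFS-v1 or DFS-v2 from $s$ starting at $t_s$. Let $V_T$ be the set of distinct vertices having at least one occurrence in $T$, and $V_R$ the set of vertices reachable from $s$ starting at $t_s$. Then $V_T=V_R$.
   Context: A temporal graph is $G=(V,E)$ with $V$ a finite vertex set and $E$ a finite set of temporal edges $(u,v,t)$, $u\neq v$, $t$ real; distinct temporal edges from $u$ to $v$ have distinct times. Reachability: a vertex $v$ is reachable from $s$ starting at $t_s$ if $v=s$, or there are temporal edges $(w_1,w_2,t_1),\dots,(w_k,w_{k+1},t_k)\in E$, $k\ge1$, with $w_1=s$, $w_{k+1}=v$ and $t_s\le t_1\le t_2\le\dots\le t_k$. Temporal DFS from $s$ with starting time $t_s$: keep $\sigma(x)$ for every vertex, initially $\infty$; build a rooted tree $T$ of occurrences of vertices. Visit $s$: set $\sigma(s)=t_s$, create the root (an occurrence of $s$), make it current. Repeat: (a) Let $u$ be the current occurrence's vertex. DFS-v1: for each out-neighbor $v$ of $u$ let $E_{u,v}$ be the set of not-yet-traversed edges $(u,v,t)\in E$ with $\sigma(u)\le t$; if some $E_{u,v}\neq\emptyset$, choose such $v$, traverse the edge of $E_{u,v}$ of minimum time and go to (b). DFS-v2: let $E_u$ be the set of not-yet-traversed edges $(u,v,t)\in E$ leaving $u$ with $\sigma(u)\le t$; if $E_u\neq\emptyset$, traverse an edge of $E_u$ of maximum time and go to (b). In either version, if no edge is available: terminate if the current occurrence is the root, otherwise backtrack to the parent occurrence and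 repeat (a). (b) After traversing $(u,v,t)$: if $\sigma(v)>t$, set $\sigma(v)=t$, create a new occurrence of $v$ as a child of the current occurrence, make it current, and go to (a); otherwise repeat (a). -}

module Defs where

open import Data.Nat using (ℕ)
open import Data.Fin using (Fin; _≟_)
open import Data.Maybe using (Maybe; just; nothing)
open import Data.List using (List; []; _∷_; _++_; [_]; length; map)
open import Data.List.Membership.Propositional using (_∈_; _∉_)
open import Data.Product using (Σ; ∃; _×_; _,_; proj₁; proj₂)
open import Data.Sum using (_⊎_)
open import Data.Unit using (⊤)
open import Data.Empty using (⊥)
open import Relation.Nullary using (¬_; does)
open import Relation.Binary.PropositionalEquality using (_≡_; _≢_)
open import Data.Bool using (if_then_else_)

record Edge (A : Set) (n : ℕ) : Set where
  constructor edge
  field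
    src  : Fin n
    tgt  : Fin n
    time : A
open Edge public

data Version : Set where
  v1 v2 : Version

module Temporal {A : Set} (_≤_ : A → A → Set) {n : ℕ} (E : List (Edge A n)) where

  _<_ : A → A → Set
  a < b = (a ≤ b) × (a ≢ b)

  data ReachFrom : Fin n → A → Fin n → Set where
    last : ∀ {u v t0 t} → edge u v t ∈ E → t0 ≤ t → ReachFrom u t0 v
    cons : ∀ {u w v t0 t} → edge u w t ∈ E → t0 ≤ t → ReachFrom w t v → ReachFrom u t0 v

  Reachable : Fin n → A → Fin n → Set
  Reachable s ts v = (v ≡ s) ⊎ ReachFrom s ts v

  -- σ-values: nothing = ∞.
  _≤∞_ : Maybe A → A → Set
  nothing ≤∞ t = ⊥
  just x  ≤∞ t = x ≤ t

  _>∞_ : Maybe A → A → Set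
  nothing >∞ t = ⊤
  just x  >∞ t = t < x

  -- An occurrence of a vertex in the DFS tree: its vertex and the index
  -- (in creation order) of its parent occurrence (nothing for the root).
  Occurrence : Set
  Occurrence = Fin n × Maybe ℕ

  record State : Set where
    field
      σ     : Fin n → Maybe A
      used  : List (Edge A n)
      tree  : List Occurrence            -- occurrences, index = creation order
      stack : List (ℕ × Fin n)           -- path from current occurrence up to root
                                         -- (occurrence index, its vertex)
  open State public

  setσ : (Fin n → Maybe A) → Fin n → A → Fin n → Maybe A
  setσ σ' v t x = if does (x ≟ v) then just t else σ' x

  initial : Fin n → A → State
  initial s ts = record
    { σ = setσ (λ _ → nothing) s ts
    ; used = []
    ; tree = [ (s , nothing) ]
    ; stack = [ (0 , s) ]
    }

  Available : State → Fin n → Edge A n → Set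
  Available st u e = (e ∈ E) × (src e ≡ u) × (e ∉ used st) × (σ st u ≤∞ time e)

  NoAvailable : State → Fin n → Set
  NoAvailable st u = ∀ e → ¬ Available st u e

  Choice : Version → State → Fin n → Edge A n → Set
  -- v1: some target v with E_{u,v} ≠ ∅ (arbitrary), edge of minimum time in E_{u,v}
  Choice v1 st u e = ∀ e' → Available st u e' → tgt e' ≡ tgt e → time e ≤ time e'
  Choice v2 st u e = ∀ e' → Available st u e' → time e' ≤ time e

  data Step (ver : Version) : State → State → Set where
    traverse-new : ∀ {st c u rest e} →
      stack st ≡ (c , u) ∷ rest →
      Available st u e → Choice ver st u e →
      σ st (tgt e) >∞ time e →
      Step ver st record
        { σ = setσ (σ st) (tgt e) (time e)
        ; used = e ∷ used st
        ; tree = tree st ++ [ (tgt e , just c) ]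
        ; stack = (length (tree st) , tgt e) ∷ stack st
        }
    traverse-old : ∀ {st c u rest e} →
      stack st ≡ (c , u) ∷ rest →
      Available st u e → Choice ver st u e →
      ¬ (σ st (tgt e) >∞ time e) →
      Step ver st record
        { σ = σ st
        ; used = e ∷ used st
        ; tree = tree st
        ; stack = stack st
        }
    backtrack : ∀ {st o p rest} →
      stack st ≡ o ∷ p ∷ rest →
      NoAvailable st (proj₂ o) →
      Step ver st record
        { σ = σ st
        ; used = used st
        ; tree = tree st
        ; stack = p ∷ rest
        }

  Terminated : State → Set
  Terminated st = Σ (ℕ × Fin n) λ o → (stack st ≡ [ o ]) × NoAvailable st (proj₂ o)

  InTree : State → Fin n → Set
  InTree st v = v ∈ map proj₁ (tree st)

module Submission where

-- The proof is an invariant argument over the run of the DFS.  Writing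
-- σ(x) ≼ t for "σ(x) is not above t", every reachable state satisfies:
--   * σ(x) = t only if some temporal walk from s at ts arrives at x at time t;
--   * x occurs in the tree exactly when σ(x) is finite, and σ(s) ≼ ts;
--   * every traversed edge e satisfies σ(tgt e) ≼ time e;
--   * a vertex not on the DFS stack has no untraversed usable out-edge.
-- The invariant holds initially and is preserved by every step of either
-- version.  Soundness of the tree then
-- follows from the first two items.  For completeness, at termination the
-- stack is just the root, which is idle, so no vertex has a usable
-- untraversed out-edge; hence σ(src e) ≼ time e implies σ(tgt e) ≼ time e,
-- and induction along a temporal walk shows its endpoint gets a finite label.
-- Because ≤ is total but not decidable, "σ ≤ t" is recovered from "σ ≼ t"
-- only up to double negation; all conclusions drawn from it are negative
-- statements, so no classical reasoning is needed.

open import Defs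
open import Data.Nat using (ℕ)
open import Data.Fin using (Fin; _≟_)
open import Data.List using (List; []; _∷_; _++_; [_]; map; length)
open import Data.List.Properties using (map-++)
open import Data.List.Membership.Propositional using (_∈_; _∉_)
open import Data.List.Membership.Propositional.Properties using (∈-++⁺ˡ; ∈-++⁺ʳ; ∈-++⁻)
open import Data.List.Relation.Unary.Any using (here; there)
open import Data.List.Relation.Unary.Unique.Propositional using (Unique)
open import Data.Maybe using (Maybe; just; nothing)
open import Data.Maybe.Properties using (just-injective)
open import Data.Product using (_×_; _,_; proj₁; proj₂; ∃)
open import Data.Sum using (_⊎_; inj₁; inj₂; map₂)
open import Data.Empty using (⊥-elim)
open import Relation.Nullary using (¬_; yes; no)
open import Relation.Binary.PropositionalEquality using (_≡_; _≢_; refl; sym; trans; subst)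
open import Relation.Binary.Structures using (IsTotalOrder)
open import Relation.Binary.Construct.Closure.ReflexiveTransitive using (Star; ε; _◅_)
import Relation.Binary.Construct.NonStrictToStrict as Strict

module _ {B C : Set} (f : B → C) (xs : List B) (y : B) where

  ∈-map-snoc⁻ : ∀ {x} → x ∈ map f (xs ++ [ y ]) → x ∈ map f xs ⊎ x ≡ f y
  ∈-map-snoc⁻ m with ∈-++⁻ (map f xs) (subst (_ ∈_) (map-++ f xs [ y ]) m)
  ... | inj₁ m′ = inj₁ m′
  ... | inj₂ (here p) = inj₂ p

  ∈-map-snoc⁺ : ∀ {x} → x ∈ map f xs ⊎ x ≡ f y → x ∈ map f (xs ++ [ y ])
  ∈-map-snoc⁺ m = subst (_ ∈_) (sym (map-++ f xs [ y ])) (lift m)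
    where
    lift : ∀ {x} → x ∈ map f xs ⊎ x ≡ f y → x ∈ map f xs ++ [ f y ]
    lift (inj₁ m′) = ∈-++⁺ˡ m′
    lift (inj₂ p) = ∈-++⁺ʳ (map f xs) (here p)

module Correctness {A : Set} {_≤_ : A → A → Set} (tot : IsTotalOrder _≡_ _≤_)
                   {n : ℕ} (E : List (Edge A n)) where
  open Temporal _≤_ E
  open IsTotalOrder tot using (isPartialOrder; antisym; total) renaming (refl to ≤-refl; trans to ≤-trans)
  open Strict _≡_ _≤_ using (<-trans; ≤-<-trans; ≤⇒≯; ≰⇒>)

  -- Extended times (nothing = ∞): the negative order "m is not above t".
  -- Unlike _≤∞_ it is stable under double negation.
  _≼_ : Maybe A → A → Set
  m ≼ t = ¬ (m >∞ t)

  ≤∞⇒≼ : ∀ m {t} → m ≤∞ t → m ≼ t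
  ≤∞⇒≼ (just x) x≤t = ≤⇒≯ antisym x≤t

  ≼-weaken : ∀ m {a b} → m ≼ a → a ≤ b → m ≼ b
  ≼-weaken nothing m≼a _ = ⊥-elim (m≼a _)
  ≼-weaken (just x) m≼a a≤b b<x = m≼a (≤-<-trans ≤-trans antisym (λ eq → subst (_≤ _) eq) a≤b b<x)

  ≼⇒finite : ∀ m {t} → m ≼ t → ∃ λ a → m ≡ just a
  ≼⇒finite nothing m≼t = ⊥-elim (m≼t _)
  ≼⇒finite (just a) _ = a , refl

  -- Totality recovers the positive order, up to double negation.
  ≼⇒¬¬≤∞ : ∀ m {t} → m ≼ t → ¬ ¬ (m ≤∞ t)
  ≼⇒¬¬≤∞ nothing m≼t _ = m≼t _
  ≼⇒¬¬≤∞ (just x) m≼t x≰t = m≼t (≰⇒> sym (λ { refl → ≤-refl }) total x≰t)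

  lowered-≼ : ∀ m {t b} → m >∞ t → m ≼ b → just t ≼ b
  lowered-≼ nothing _ m≼b = ⊥-elim (m≼b _)
  lowered-≼ (just x) t<x m≼b b<t = m≼b (<-trans isPartialOrder b<t t<x)

  setσ-cases : ∀ σ′ v t x → (x ≡ v × setσ σ′ v t x ≡ just t) ⊎ (x ≢ v × setσ σ′ v t x ≡ σ′ x)
  setσ-cases σ′ v t x with x ≟ v
  ... | yes p = inj₁ (p , refl)
  ... | no p = inj₂ (p , refl)

  setσ-hit : ∀ σ′ v t → setσ σ′ v t v ≡ just t
  setσ-hit σ′ v t with setσ-cases σ′ v t v
  ... | inj₁ (_ , q) = q
  ... | inj₂ (p , _) = ⊥-elim (p refl)

  setσ-≼ : ∀ σ′ {v t} x {b} → σ′ v >∞ t → σ′ x ≼ b → setσ σ′ v t x ≼ b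
  setσ-≼ σ′ {v} {t} x gt x≼b with setσ-cases σ′ v t x
  ... | inj₂ (_ , q) rewrite q = x≼b
  ... | inj₁ (refl , q) rewrite q = lowered-≼ (σ′ x) gt x≼b

  Exhausted : Maybe A → List (Edge A n) → Fin n → Set
  Exhausted m us u = ∀ e → e ∈ E → src e ≡ u → m ≤∞ time e → ¬ e ∉ us

  exhausted-∷ : ∀ {m us u} e → Exhausted m us u → Exhausted m (e ∷ us) u
  exhausted-∷ _ ex e′ e′∈E src≡u le e′∉ = ex e′ e′∈E src≡u le (λ m → e′∉ (there m))

  idle⇒exhausted : ∀ st u → NoAvailable st u → Exhausted (σ st u) (used st) u
  idle⇒exhausted st u idle e e∈E src≡u le e∉ = idle e (e∈E , src≡u , e∉ , le)

  module FromSource (s : Fin n) (ts : A) where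

    -- A temporal walk from s at ts arriving at x at time t (built edge by
    -- edge at the end, as the DFS builds it).
    data ArrivesAt : Fin n → A → Set where
      start : ArrivesAt s ts
      extend : ∀ {u v a t} → ArrivesAt u a → edge u v t ∈ E → a ≤ t → ArrivesAt v t

    prefix : ∀ {u a v} → ArrivesAt u a → ReachFrom u a v → ReachFrom s ts v
    prefix start r = r
    prefix (extend w e∈E a≤t) r = prefix w (cons e∈E a≤t r)

    arrives⇒reachable : ∀ {v t} → ArrivesAt v t → Reachable s ts v
    arrives⇒reachable start = inj₁ refl
    arrives⇒reachable (extend w e∈E a≤t) = inj₂ (prefix w (last e∈E a≤t))

    Justified : Maybe A → Fin n → Set
    Justified m x = ∀ {t} → m ≡ just t → ArrivesAt x t

    traverse-justified : ∀ m {e u} → Justified m u → e ∈ E → src e ≡ u → m ≤∞ time e →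
                         ArrivesAt (tgt e) (time e)
    traverse-justified (just a) j e∈E refl a≤t = extend (j refl) e∈E a≤t

    record Invariant (st : State) : Set where
      field
        justified : ∀ x → Justified (σ st x) x
        tree⇒label : ∀ {x} → InTree st x → ∃ λ t → σ st x ≡ just t
        label⇒tree : ∀ {x t} → σ st x ≡ just t → InTree st x
        root-settled : σ st s ≼ ts
        used-settled : ∀ {e} → e ∈ used st → σ st (tgt e) ≼ time e
        closed : ∀ u → u ∈ map proj₂ (stack st) ⊎ Exhausted (σ st u) (used st) u
    open Invariant

    initial-inv : Invariant (initial s ts)
    initial-inv = record
      { justified = justified₀
      ; tree⇒label = λ { (here refl) → ts , setσ-hit _ s ts }
      ; label⇒tree = label⇒tree₀
      ; root-settled = subst (_≼ ts) (sym (setσ-hit _ s ts)) (≤∞⇒≼ (just ts) ≤-refl)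
      ; used-settled = λ ()
      ; closed = closed₀
      }
      where
      σ₀ = setσ (λ _ → nothing) s ts
      justified₀ : ∀ x → Justified (σ₀ x) x
      justified₀ x eq with setσ-cases (λ _ → nothing) s ts x
      ... | inj₁ (refl , q) with just-injective (trans (sym q) eq)
      ...   | refl = start
      justified₀ x eq | inj₂ (_ , q) with trans (sym q) eq
      ... | ()
      label⇒tree₀ : ∀ {x t} → σ₀ x ≡ just t → InTree (initial s ts) x
      label⇒tree₀ {x} eq with setσ-cases (λ _ → nothing) s ts x
      ... | inj₁ (p , _) = here p
      ... | inj₂ (_ , q) with trans (sym q) eq
      ...   | ()
      closed₀ : ∀ u → u ∈ [ s ] ⊎ Exhausted (σ₀ u) [] u
      closed₀ u with setσ-cases (λ _ → nothing) s ts u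
      ... | inj₁ (p , _) = inj₁ (here p)
      ... | inj₂ (_ , q) = inj₂ (λ e _ _ le → ⊥-elim (subst (_≤∞ time e) q le))

    visit : State → ℕ → Edge A n → State
    visit st c e = record
      { σ = setσ (σ st) (tgt e) (time e)
      ; used = e ∷ used st
      ; tree = tree st ++ [ (tgt e , just c) ]
      ; stack = (length (tree st) , tgt e) ∷ stack st
      }

    mark : State → Edge A n → State
    mark st e = record st { used = e ∷ used st }

    pop : State → ℕ × Fin n → List (ℕ × Fin n) → State
    pop st p rest = record st { stack = p ∷ rest }

    -- Improving tgt e: the new label is justified by the label of u, the new
    -- occurrence carries it, and tgt e goes on the stack.
    visit-inv : ∀ {st c u e} → Available st u e → σ st (tgt e) >∞ time e →
                Invariant st → Invariant (visit st c e)
    visit-inv {st} {c} {u} {e} (e∈E , src≡u , _ , le) gt I = record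
      { justified = justified′
      ; tree⇒label = tree⇒label′
      ; label⇒tree = label⇒tree′
      ; root-settled = setσ-≼ (σ st) s gt (root-settled I)
      ; used-settled = used-settled′
      ; closed = closed′
      }
      where
      σ′ = setσ (σ st) (tgt e) (time e)
      new = (tgt e , just c)
      justified′ : ∀ x → Justified (σ′ x) x
      justified′ x eq with setσ-cases (σ st) (tgt e) (time e) x
      ... | inj₂ (_ , q) = justified I x (trans (sym q) eq)
      ... | inj₁ (refl , q) with just-injective (trans (sym q) eq)
      ...   | refl = traverse-justified (σ st u) (justified I u) e∈E src≡u le
      tree⇒label′ : ∀ {x} → x ∈ map proj₁ (tree st ++ [ new ]) → ∃ λ t → σ′ x ≡ just t
      tree⇒label′ {x} m with setσ-cases (σ st) (tgt e) (time e) x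
      ... | inj₁ (_ , q) = time e , q
      ... | inj₂ (x≢ , q) with ∈-map-snoc⁻ proj₁ (tree st) new m
      ...   | inj₁ m′ = let (t , r) = tree⇒label I m′ in t , trans q r
      ...   | inj₂ p = ⊥-elim (x≢ p)
      label⇒tree′ : ∀ {x t} → σ′ x ≡ just t → x ∈ map proj₁ (tree st ++ [ new ])
      label⇒tree′ {x} eq with setσ-cases (σ st) (tgt e) (time e) x
      ... | inj₁ (p , _) = ∈-map-snoc⁺ proj₁ (tree st) new (inj₂ p)
      ... | inj₂ (_ , q) = ∈-map-snoc⁺ proj₁ (tree st) new (inj₁ (label⇒tree I (trans (sym q) eq)))
      used-settled′ : ∀ {e′} → e′ ∈ e ∷ used st → σ′ (tgt e′) ≼ time e′
      used-settled′ (here refl) = subst (_≼ time e) (sym (setσ-hit (σ st) (tgt e) (time e))) (≤∞⇒≼ (just (time e)) ≤-refl)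
      used-settled′ {e′} (there m) = setσ-≼ (σ st) (tgt e′) gt (used-settled I m)
      closed′ : ∀ x → x ∈ map proj₂ (stack (visit st c e)) ⊎ Exhausted (σ′ x) (e ∷ used st) x
      closed′ x with setσ-cases (σ st) (tgt e) (time e) x | closed I x
      ... | inj₁ (p , _) | _ = inj₁ (here p)
      ... | inj₂ _ | inj₁ m = inj₁ (there m)
      ... | inj₂ (_ , q) | inj₂ ex = inj₂ (subst (λ m → Exhausted m _ x) (sym q) (exhausted-∷ {σ st x} e ex))

    -- Traversing e without improvement: by the rule, σ(tgt e) ≼ time e.
    mark-inv : ∀ {st e} → ¬ (σ st (tgt e) >∞ time e) → Invariant st → Invariant (mark st e)
    mark-inv {st} {e} not-improved I = record
      { justified = justified I
      ; tree⇒label = tree⇒label I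
      ; label⇒tree = label⇒tree I
      ; root-settled = root-settled I
      ; used-settled = λ { (here refl) → not-improved ; (there m) → used-settled I m }
      ; closed = λ x → map₂ (exhausted-∷ {σ st x} e) (closed I x)
      }

    -- Backtracking leaves the popped vertex idle, hence exhausted.
    pop-inv : ∀ {st o p rest} → stack st ≡ o ∷ p ∷ rest → NoAvailable st (proj₂ o) →
              Invariant st → Invariant (pop st p rest)
    pop-inv {st} eq idle I = record
      { justified = justified I
      ; tree⇒label = tree⇒label I
      ; label⇒tree = label⇒tree I
      ; root-settled = root-settled I
      ; used-settled = used-settled I
      ; closed = closed′
      }
      where
      closed′ : ∀ x → _ ⊎ Exhausted (σ st x) (used st) x
      closed′ x with closed I x
      ... | inj₂ ex = inj₂ ex
      ... | inj₁ m with subst (λ l → x ∈ map proj₂ l) eq m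
      ...   | there m′ = inj₁ m′
      ...   | here refl = inj₂ (idle⇒exhausted st x idle)

    step-inv : ∀ {ver st st′} → Step ver st st′ → Invariant st → Invariant st′
    step-inv (traverse-new _ av _ gt) = visit-inv av gt
    step-inv (traverse-old _ _ _ not-improved) = mark-inv not-improved
    step-inv (backtrack eq idle) = pop-inv eq idle

    run-inv : ∀ {ver st st′} → Star (Step ver) st st′ → Invariant st → Invariant st′
    run-inv ε I = I
    run-inv (step ◅ steps) I = run-inv steps (step-inv step I)

    tree⇒reachable : ∀ {st} → Invariant st → ∀ {v} → InTree st v → Reachable s ts v
    tree⇒reachable I m = let (_ , eq) = tree⇒label I m in arrives⇒reachable (justified I _ eq)

    module Terminal (st : State) (I : Invariant st) (term : Terminated st) where

      exhausted : ∀ u → Exhausted (σ st u) (used st) u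
      exhausted u with closed I u
      ... | inj₂ ex = ex
      ... | inj₁ m with subst (λ l → u ∈ map proj₂ l) (proj₁ (proj₂ term)) m
      ...   | here refl = idle⇒exhausted st u (proj₂ (proj₂ term))

      propagate : ∀ {e} → e ∈ E → σ st (src e) ≼ time e → σ st (tgt e) ≼ time e
      propagate {e} e∈E src≼ tgt> =
        ≼⇒¬¬≤∞ (σ st (src e)) src≼ λ le →
          exhausted (src e) e e∈E refl le λ e∈used → used-settled I e∈used tgt>

      settled⇒tree : ∀ {x t} → σ st x ≼ t → InTree st x
      settled⇒tree {x} x≼ = label⇒tree I (proj₂ (≼⇒finite (σ st x) x≼))

      walk⇒tree : ∀ {u t₀ v} → ReachFrom u t₀ v → σ st u ≼ t₀ → InTree st v
      walk⇒tree {u} (last e∈E t₀≤t) u≼ = settled⇒tree (propagate e∈E (≼-weaken (σ st u) u≼ t₀≤t))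
      walk⇒tree {u} (cons e∈E t₀≤t r) u≼ = walk⇒tree r (propagate e∈E (≼-weaken (σ st u) u≼ t₀≤t))

      reachable⇒tree : ∀ {v} → Reachable s ts v → InTree st v
      reachable⇒tree (inj₁ refl) = settled⇒tree (root-settled I)
      reachable⇒tree (inj₂ r) = walk⇒tree r (root-settled I)

-- The theorem: V_T = V_R.
lemma6 : {A : Set} (_≤_ : A → A → Set) → IsTotalOrder _≡_ _≤_ →
         (n : ℕ) (E : List (Edge A n)) → Unique E →
         (∀ e → e ∈ E → src e ≢ tgt e) →
         (s : Fin n) (ts : A) (ver : Version) (final : Temporal.State _≤_ E) →
         Star (Temporal.Step _≤_ E ver) (Temporal.initial _≤_ E s ts) final →
         Temporal.Terminated _≤_ E final →
         (v : Fin n) →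
         (Temporal.InTree _≤_ E final v → Temporal.Reachable _≤_ E s ts v) ×
         (Temporal.Reachable _≤_ E s ts v → Temporal.InTree _≤_ E final v)
lemma6 _≤_ tot n E _ _ s ts ver final run term v = tree⇒reachable I , reachable⇒tree
  where
  open Correctness tot E
  open FromSource s ts
  I = run-inv run initial-inv
  open Terminal final I term
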